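{- Let $S$ be an $m\times n$ sign pattern that allows row orthogonality, such that all zero entries of $S$ are contained in at most three rows of $S$ and no pair of rows of $S$ is combinatorially orthogonal. Then $S$ requires o-SIPP.
   Context: A sign pattern is an array with entries in $\{+,-,0\}$; $\operatorname{sgn}$ of a real matrix is taken entrywise. Two rows $i,k$ of a pattern $P=[p_{ij}]$ are combinatorially orthogonal if for every column $j$, $p_{ij}\ne0$ implies $p_{kj}=0$. A real matrix $Q$ is row orthogonal if $QQ^T=I$; $S$ allows row orthogonality if some row orthogonal $Q$ has $\operatorname{sgn}(Q)=S$. A wide real $m\times n$ matrix $A$ has the SIPP if the only real symmetric $m\times m$ matrix $X$ with $(XA)\circ A=O$ ($\circ$ entrywise product) is $X=O$. $S$ requires o-SIPP if there is a row orthogonal $Q$ with $\operatorname{sgn}(Q)=S$ and every such $Q$ has the SIPP. -}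

module Defs where

open import Level using (0ℓ)
open import Algebra.Bundles using (CommutativeRing)
open import Relation.Binary.Core using (Rel)
open import Relation.Binary.Definitions using (Trichotomous; Transitive)
open import Relation.Unary using (Pred)
open import Relation.Binary.PropositionalEquality using (_≡_; _≢_)
open import Relation.Nullary using (¬_; yes; no)
open import Data.Product using (Σ; _×_)
open import Data.Sum using (_⊎_)
open import Data.Nat using (ℕ; _≤_)
open import Data.Fin using (Fin; zero; suc; _≟_)
open import Data.List using (List; length)
open import Data.List.Membership.Propositional using (_∈_)

-- The real numbers, axiomatised as a (Dedekind-)complete ordered field.
-- Any two such structures are isomorphic, so quantifying over all of
-- them amounts to speaking about ℝ.

record RealField : Set₁ where
  field
    commRing : CommutativeRing 0ℓ 0ℓ
  open CommutativeRing commRing public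
  field
    _<_        : Rel Carrier 0ℓ
    0≉1        : ¬ (0# ≈ 1#)
    inverse    : ∀ x → ¬ (x ≈ 0#) → Σ Carrier (λ y → (x * y) ≈ 1#)
    <-resp-≈   : ∀ {x x′ y y′} → x ≈ x′ → y ≈ y′ → x < y → x′ < y′
    <-trans    : Transitive _<_
    <-tri      : Trichotomous _≈_ _<_
    +-mono-<   : ∀ {x y} z → x < y → (x + z) < (y + z)
    *-pos      : ∀ {x y} → 0# < x → 0# < y → 0# < (x * y)
    complete   : (A : Pred Carrier 0ℓ) → Σ Carrier A →
                 Σ Carrier (λ b → ∀ a → A a → (a < b) ⊎ (a ≈ b)) →
                 Σ Carrier (λ s → (∀ a → A a → (a < s) ⊎ (a ≈ s))
                                × (∀ b → (∀ a → A a → (a < b) ⊎ (a ≈ b)) →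
                                         (s < b) ⊎ (s ≈ b)))

data Sign : Set where
  plus minus zer : Sign

SignPattern : ℕ → ℕ → Set
SignPattern m n = Fin m → Fin n → Sign

CombOrth : ∀ {m n} → SignPattern m n → Fin m → Fin m → Set
CombOrth S i k = ∀ j → S i j ≢ zer → S k j ≡ zer

ZerosInAtMostThreeRows : ∀ {m n} → SignPattern m n → Set
ZerosInAtMostThreeRows {m} S =
  Σ (List (Fin m)) (λ R → (length R ≤ 3) × (∀ i j → S i j ≡ zer → i ∈ R))

NoCombOrthPair : ∀ {m n} → SignPattern m n → Set
NoCombOrthPair S = ∀ i k → i ≢ k → ¬ CombOrth S i k

module Matrices (ℝ : RealField) where
  open RealField ℝ

  Matrix : ℕ → ℕ → Set
  Matrix m n = Fin m → Fin n → Carrier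

  sumFin : ∀ {n} → (Fin n → Carrier) → Carrier
  sumFin {ℕ.zero}  f = 0#
  sumFin {ℕ.suc n} f = f Fin.zero + sumFin (λ j → f (Fin.suc j))

  mul : ∀ {m k n} → Matrix m k → Matrix k n → Matrix m n
  mul A B i j = sumFin (λ l → A i l * B l j)

  transpose : ∀ {m n} → Matrix m n → Matrix n m
  transpose A i j = A j i

  identity : ∀ {m} → Matrix m m
  identity i j with i ≟ j
  ... | yes _ = 1#
  ... | no  _ = 0#

  _≈ᴹ_ : ∀ {m n} → Matrix m n → Matrix m n → Set
  A ≈ᴹ B = ∀ i j → A i j ≈ B i j

  HasSign : Carrier → Sign → Set
  HasSign x plus  = 0# < x
  HasSign x minus = x < 0#
  HasSign x zer   = x ≈ 0#

  HasSignPattern : ∀ {m n} → Matrix m n → SignPattern m n → Set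
  HasSignPattern Q S = ∀ i j → HasSign (Q i j) (S i j)

  RowOrthogonal : ∀ {m n} → Matrix m n → Set
  RowOrthogonal Q = mul Q (transpose Q) ≈ᴹ identity

  AllowsRowOrthogonality : ∀ {m n} → SignPattern m n → Set
  AllowsRowOrthogonality {m} {n} S =
    Σ (Matrix m n) (λ Q → RowOrthogonal Q × HasSignPattern Q S)

  Symmetric : ∀ {m} → Matrix m m → Set
  Symmetric X = ∀ i j → X i j ≈ X j i

  _∘ᴴ_ : ∀ {m n} → Matrix m n → Matrix m n → Matrix m n
  (A ∘ᴴ B) i j = A i j * B i j

  zeroMatrix : ∀ {m n} → Matrix m n
  zeroMatrix _ _ = 0#

  -- strong inner product property (for wide m × n matrices, m ≤ n)
  SIPP : ∀ {m n} → Matrix m n → Set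
  SIPP {m} A = (X : Matrix m m) → Symmetric X →
               (mul X A ∘ᴴ A) ≈ᴹ zeroMatrix → X ≈ᴹ zeroMatrix

  RequiresOSIPP : ∀ {m n} → SignPattern m n → Set
  RequiresOSIPP {m} {n} S =
    AllowsRowOrthogonality S ×
    ((Q : Matrix m n) → RowOrthogonal Q → HasSignPattern Q S → SIPP Q)

module Submission where

open import Defs
open import Data.Nat using (ℕ)

open import Function using (_∘_)
open import Data.Product using (_×_; _,_; ∃-syntax)
import Data.Nat as ℕ
open import Data.Nat.Properties using (≮⇒≥; ≤-trans)
open import Data.Fin as Fin using (Fin; punchIn; punchOut)
open import Data.Fin.Properties
  using (pigeonhole; <⇒≢; any?; punchInᵢ≢i; punchIn-injective; punchIn-punchOut)
open import Data.List using (List; []; _∷_; length; lookup)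
open import Data.List.Membership.Propositional using (_∈_)
open import Data.List.Membership.Propositional.Properties using (∈-lookup)
open import Data.List.Relation.Binary.Subset.Propositional using (_⊆_)
open import Data.List.Relation.Unary.All as All using ([]; _∷_)
open import Data.List.Relation.Unary.AllPairs using ([]; _∷_)
open import Data.List.Relation.Unary.Any as Any using (here; there; index)
open import Data.List.Relation.Unary.Any.Properties using (lookup-index)
open import Data.List.Relation.Unary.Unique.Propositional using (Unique)
open import Relation.Nullary using (¬_; Dec; yes; no; contradiction)
open import Relation.Nullary.Decidable using (¬?; _×-dec_; decidable-stable)
open import Relation.Binary.PropositionalEquality as ≡ using (_≡_; _≢_)
open import Relation.Binary.Definitions using (tri<; tri≈; tri>)
import Algebra.Properties.Ring as RingProperties
import Algebra.Properties.Semiring.Sum as SemiringSum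
import Algebra.Solver.Ring.NaturalCoefficients.Default as NaturalSolver

-- Let Q be row orthogonal with sign pattern S, X symmetric with (XQ) ∘ Q = O, and Y = XQ.
-- Then X = YQᵀ, so X_ii = Σ_j Y_ij Q_ij = 0, and if row i of S has no zero then row i
-- of Y vanishes and so does row i of X.  Hence, X being symmetric, all nonzero entries of
-- X lie in the at most three rows and columns carrying the zeros of S.  For a ≠ b choose
-- a column j in which rows a and b of S are both nonzero, so that Y_aj = Y_bj = 0.  If
-- X_ab ≠ 0, then either X_ab is the only off-diagonal nonzero entry of row a, and
-- 0 = Y_aj = X_ab Q_bj is absurd, or there is a third index c and X is supported on
-- {a, b, c}; the three equations Y_aj = 0, Y_bj = 0, Y_cj Q_cj = 0 then force
-- 2 X_ab Q_aj Q_bj = 0, again absurd.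

module _ {A : Set} where

  Unique-lookup-injective : ∀ {xs : List A} → Unique xs →
                            ∀ {i j} → lookup xs i ≡ lookup xs j → i ≡ j
  Unique-lookup-injective (_ ∷ _)       {Fin.zero}  {Fin.zero}  _  = ≡.refl
  Unique-lookup-injective (x≢xs ∷ _)    {Fin.zero}  {Fin.suc j} eq =
    contradiction eq (All.lookup x≢xs (∈-lookup j))
  Unique-lookup-injective (x≢xs ∷ _)    {Fin.suc i} {Fin.zero}  eq =
    contradiction (≡.sym eq) (All.lookup x≢xs (∈-lookup i))
  Unique-lookup-injective (_ ∷ unique)  {Fin.suc i} {Fin.suc j} eq =
    ≡.cong Fin.suc (Unique-lookup-injective unique eq)

  Unique-⊆⇒length≤ : ∀ {xs ys : List A} → Unique xs → xs ⊆ ys → length xs ℕ.≤ length ys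
  Unique-⊆⇒length≤ {xs} {ys} unique xs⊆ys = ≮⇒≥ λ ys<xs →
    let i , j , i<j , same = pigeonhole ys<xs (index ∘ position) in
    <⇒≢ i<j (Unique-lookup-injective unique (begin
      lookup xs i                      ≡⟨ lookup-index (position i) ⟩
      lookup ys (index (position i))   ≡⟨ ≡.cong (lookup ys) same ⟩
      lookup ys (index (position j))   ≡⟨ lookup-index (position j) ⟨
      lookup xs j                      ∎))
    where
    open ≡.≡-Reasoning
    position : ∀ k → lookup xs k ∈ ys
    position k = xs⊆ys (∈-lookup k)

sign-zer? : (s : Sign) → Dec (s ≡ zer)
sign-zer? plus  = no λ ()
sign-zer? minus = no λ ()
sign-zer? zer   = yes ≡.refl

¬CombOrth⇒commonSupport : ∀ {m n} (S : SignPattern m n) {i k} → ¬ CombOrth S i k →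
                          ∃[ j ] (S i j ≢ zer × S k j ≢ zer)
¬CombOrth⇒commonSupport S {i} {k} ¬orth
  with any? (λ j → ¬? (sign-zer? (S i j)) ×-dec ¬? (sign-zer? (S k j)))
... | yes common  = common
... | no ¬common = contradiction orth ¬orth
  where
  orth : CombOrth S i k
  orth j Sij≢0 = decidable-stable (sign-zer? (S k j)) (λ Skj≢0 → ¬common (j , Sij≢0 , Skj≢0))

module _ (ℝ : RealField) where
  open RealField ℝ hiding (zero)
  open Matrices ℝ
  open RingProperties ring using (-1*x≈-x; -‿involutive)
  open SemiringSum semiring using (sum; sum-cong-≋; sum-replicate-zero; sum-remove;
                                    ∑-comm; *-distribˡ-sum; *-distribʳ-sum)
  open NaturalSolver commutativeSemiring using (solve; _:=_; _:+_; _:*_)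
  open import Relation.Binary.Reasoning.Setoid setoid

  ≈0? : ∀ x → Dec (x ≈ 0#)
  ≈0? x with <-tri x 0#
  ... | tri< _ x≉0 _ = no x≉0
  ... | tri≈ _ x≈0 _ = yes x≈0
  ... | tri> _ x≉0 _ = no x≉0

  ≈0-stable : ∀ {x} → ¬ ¬ x ≈ 0# → x ≈ 0#
  ≈0-stable {x} = decidable-stable (≈0? x)

  <-irrefl : ∀ {x} → ¬ x < x
  <-irrefl {x} x<x with <-tri x x
  ... | tri< _ _ x≯x = x≯x x<x
  ... | tri≈ x≮x _ _ = x≮x x<x
  ... | tri> x≮x _ _ = x≮x x<x

  <⇒≉ : ∀ {x y} → x < y → ¬ x ≈ y
  <⇒≉ x<y x≈y = <-irrefl (<-resp-≈ x≈y refl x<y)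

  HasSign⇒≉0 : ∀ {x} s → HasSign x s → s ≢ zer → ¬ x ≈ 0#
  HasSign⇒≉0 plus  0<x _   x≈0 = <⇒≉ 0<x (sym x≈0)
  HasSign⇒≉0 minus x<0 _   x≈0 = <⇒≉ x<0 x≈0
  HasSign⇒≉0 zer   _   s≢0 _   = s≢0 ≡.refl

  *-cancelʳ-≈0 : ∀ {x y} → ¬ y ≈ 0# → x * y ≈ 0# → x ≈ 0#
  *-cancelʳ-≈0 {x} {y} y≉0 xy≈0 with inverse y y≉0
  ... | y⁻¹ , yy⁻¹≈1 = begin
    x               ≈⟨ *-identityʳ x ⟨
    x * 1#          ≈⟨ *-congˡ yy⁻¹≈1 ⟨
    x * (y * y⁻¹)   ≈⟨ *-assoc x y y⁻¹ ⟨
    (x * y) * y⁻¹   ≈⟨ *-congʳ xy≈0 ⟩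
    0# * y⁻¹        ≈⟨ zeroˡ y⁻¹ ⟩
    0#              ∎

  0<1 : 0# < 1#
  0<1 with <-tri 0# 1#
  ... | tri< 0<1 _ _ = 0<1
  ... | tri≈ _ 0≈1 _ = contradiction 0≈1 0≉1
  ... | tri> _ _ 1<0 = contradiction (<-trans 1<0 0<1′) <-irrefl
    where
    0<-1 : 0# < (- 1#)
    0<-1 = <-resp-≈ (-‿inverseʳ 1#) (+-identityˡ (- 1#)) (+-mono-< (- 1#) 1<0)
    0<1′ : 0# < 1#
    0<1′ = <-resp-≈ refl (trans (-1*x≈-x (- 1#)) (-‿involutive 1#)) (*-pos 0<-1 0<-1)

  x+x≈0⇒x≈0 : ∀ {x} → x + x ≈ 0# → x ≈ 0#
  x+x≈0⇒x≈0 {x} x+x≈0 = *-cancelʳ-≈0 2≉0 (trans (*-comm x _) (begin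
    (1# + 1#) * x   ≈⟨ distribʳ x 1# 1# ⟩
    1# * x + 1# * x ≈⟨ +-cong (*-identityˡ x) (*-identityˡ x) ⟩
    x + x           ≈⟨ x+x≈0 ⟩
    0#              ∎))
    where
    0<2 : 0# < (1# + 1#)
    0<2 = <-trans 0<1 (<-resp-≈ (+-identityˡ 1#) refl (+-mono-< 1# 0<1))
    2≉0 : ¬ (1# + 1#) ≈ 0#
    2≉0 2≈0 = <⇒≉ 0<2 (sym 2≈0)

  -- For M = [[0,A,B],[A,0,C],[B,C,0]] and q = (qa,qb,qc):
  -- qa (Mq)_a + qb (Mq)_b − (Mq)_c qc = 2 A qa qb.
  hollow-symmetric-3×3 : ∀ {A B C qa qb qc} →
    A * qb + B * qc ≈ 0# → A * qa + C * qc ≈ 0# → (B * qa + C * qb) * qc ≈ 0# →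
    (A * qa) * qb ≈ 0#
  hollow-symmetric-3×3 {A} {B} {C} {qa} {qb} {qc} eqa eqb eqc = x+x≈0⇒x≈0 (begin
    Z + Z                                                ≈⟨ +-identityʳ (Z + Z) ⟨
    (Z + Z) + 0#                                         ≈⟨ +-congˡ eqc ⟨
    (Z + Z) + (B * qa + C * qb) * qc
      ≈⟨ solve 6 (λ A B C qa qb qc →
           ((A :* qa) :* qb :+ (A :* qa) :* qb) :+ (B :* qa :+ C :* qb) :* qc
           := qa :* (A :* qb :+ B :* qc) :+ qb :* (A :* qa :+ C :* qc))
           refl A B C qa qb qc ⟩
    qa * (A * qb + B * qc) + qb * (A * qa + C * qc)      ≈⟨ +-cong (*-congˡ eqa) (*-congˡ eqb) ⟩
    qa * 0# + qb * 0#                                    ≈⟨ +-cong (zeroʳ qa) (zeroʳ qb) ⟩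
    0# + 0#                                              ≈⟨ +-identityʳ 0# ⟩
    0#                                                   ∎)
    where Z = (A * qa) * qb

  sumFin≡sum : ∀ {n} (f : Fin n → Carrier) → sumFin f ≡ sum f
  sumFin≡sum {ℕ.zero}  f = ≡.refl
  sumFin≡sum {ℕ.suc n} f = ≡.cong (f Fin.zero +_) (sumFin≡sum (f ∘ Fin.suc))

  sum-zero : ∀ {n} (f : Fin n → Carrier) → (∀ k → f k ≈ 0#) → sum f ≈ 0#
  sum-zero {n} f f≈0 = trans (sum-cong-≋ f≈0) (sum-replicate-zero n)

  sum-single : ∀ {n} (f : Fin n → Carrier) u → (∀ k → k ≢ u → f k ≈ 0#) → sum f ≈ f u
  sum-single {ℕ.suc _} f u f≈0 = begin
    sum f                           ≈⟨ sum-remove f ⟩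
    f u + sum (f ∘ punchIn u)       ≈⟨ +-congˡ (sum-zero _ (λ k → f≈0 _ (punchInᵢ≢i u k))) ⟩
    f u + 0#                        ≈⟨ +-identityʳ (f u) ⟩
    f u                             ∎

  sum-pair : ∀ {n} (f : Fin n → Carrier) {u v} → u ≢ v →
             (∀ k → k ≢ u → k ≢ v → f k ≈ 0#) → sum f ≈ f u + f v
  sum-pair {ℕ.suc _} f {u} {v} u≢v f≈0 = begin
    sum f                                  ≈⟨ sum-remove f ⟩
    f u + sum (f ∘ punchIn u)              ≈⟨ +-congˡ (sum-single (f ∘ punchIn u) w vanish) ⟩
    f u + f (punchIn u w)                  ≡⟨ ≡.cong (λ k → f u + f k) (punchIn-punchOut u≢v) ⟩
    f u + f v                              ∎
    where
    w = punchOut u≢v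
    vanish : ∀ k → k ≢ w → f (punchIn u k) ≈ 0#
    vanish k k≢w = f≈0 _ (punchInᵢ≢i u k) λ uk≡v →
      k≢w (punchIn-injective u k w (≡.trans uk≡v (≡.sym (punchIn-punchOut u≢v))))

  mul≈sum : ∀ {m k n} (A : Matrix m k) (B : Matrix k n) i j →
            mul A B i j ≈ sum (λ l → A i l * B l j)
  mul≈sum A B i j = reflexive (sumFin≡sum (λ l → A i l * B l j))

  mul-assoc : ∀ {m k l n} (A : Matrix m k) (B : Matrix k l) (C : Matrix l n) →
              mul (mul A B) C ≈ᴹ mul A (mul B C)
  mul-assoc A B C i j = begin
    mul (mul A B) C i j                           ≈⟨ mul≈sum (mul A B) C i j ⟩
    sum (λ q → mul A B i q * C q j)               ≈⟨ sum-cong-≋ (λ q → *-congʳ (mul≈sum A B i q)) ⟩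
    sum (λ q → sum (λ p → A i p * B p q) * C q j) ≈⟨ sum-cong-≋ (λ q →
                                                       *-distribʳ-sum (C q j) (λ p → A i p * B p q)) ⟩
    sum (λ q → sum (λ p → A i p * B p q * C q j)) ≈⟨ ∑-comm (λ q p → A i p * B p q * C q j) ⟩
    sum (λ p → sum (λ q → A i p * B p q * C q j)) ≈⟨ sum-cong-≋ (λ p → sum-cong-≋ (λ q →
                                                       *-assoc (A i p) (B p q) (C q j))) ⟩
    sum (λ p → sum (λ q → A i p * (B p q * C q j))) ≈⟨ sum-cong-≋ (λ p →
                                                       *-distribˡ-sum (A i p) (λ q → B p q * C q j)) ⟨
    sum (λ p → A i p * sum (λ q → B p q * C q j)) ≈⟨ sum-cong-≋ (λ p → *-congˡ (mul≈sum B C p j)) ⟨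
    sum (λ p → A i p * mul B C p j)               ≈⟨ mul≈sum A (mul B C) i j ⟨
    mul A (mul B C) i j                           ∎

  mul-congˡ : ∀ {m k n} (A : Matrix m k) {B B′ : Matrix k n} → B ≈ᴹ B′ → mul A B ≈ᴹ mul A B′
  mul-congˡ A {B} {B′} B≈B′ i j = begin
    mul A B i j                   ≈⟨ mul≈sum A B i j ⟩
    sum (λ l → A i l * B l j)     ≈⟨ sum-cong-≋ (λ l → *-congˡ (B≈B′ l j)) ⟩
    sum (λ l → A i l * B′ l j)    ≈⟨ mul≈sum A B′ i j ⟨
    mul A B′ i j                  ∎

  mul-identityʳ : ∀ {m n} (A : Matrix m n) → mul A identity ≈ᴹ A
  mul-identityʳ A i j = begin
    mul A identity i j                ≈⟨ mul≈sum A identity i j ⟩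
    sum (λ l → A i l * identity l j)  ≈⟨ sum-single _ j (λ l l≢j → off-diagonal l≢j) ⟩
    A i j * identity j j              ≈⟨ on-diagonal ⟩
    A i j                             ∎
    where
    off-diagonal : ∀ {l} → l ≢ j → A i l * identity l j ≈ 0#
    off-diagonal {l} l≢j with l Fin.≟ j
    ... | yes l≡j = contradiction l≡j l≢j
    ... | no  _   = zeroʳ (A i l)
    on-diagonal : A i j * identity j j ≈ A i j
    on-diagonal with j Fin.≟ j
    ... | yes _   = *-identityʳ (A i j)
    ... | no  j≢j = contradiction ≡.refl j≢j

  RowOrthogonal⇒mul-transpose : ∀ {m k n} {Q : Matrix m n} → RowOrthogonal Q →
                                (X : Matrix k m) → mul (mul X Q) (transpose Q) ≈ᴹ X
  RowOrthogonal⇒mul-transpose {Q = Q} Q-ro X i j = begin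
    mul (mul X Q) (transpose Q) i j   ≈⟨ mul-assoc X Q (transpose Q) i j ⟩
    mul X (mul Q (transpose Q)) i j   ≈⟨ mul-congˡ X Q-ro i j ⟩
    mul X identity i j                ≈⟨ mul-identityʳ X i j ⟩
    X i j                             ∎

  module _ {m n} {Q : Matrix m n} (Q-ro : RowOrthogonal Q)
           {X : Matrix m m} (X-sym : Symmetric X) (XQ∘Q≈0 : (mul X Q ∘ᴴ Q) ≈ᴹ zeroMatrix)
    where

    private
      Y : Matrix m n
      Y = mul X Q

    X≈YQᵀ : ∀ i k → X i k ≈ sum (λ j → Y i j * Q k j)
    X≈YQᵀ i k =
      trans (sym (RowOrthogonal⇒mul-transpose {Q = Q} Q-ro X i k)) (mul≈sum Y (transpose Q) i k)

    Y≈0 : ∀ {i j} → ¬ Q i j ≈ 0# → Y i j ≈ 0#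
    Y≈0 {i} {j} Qij≉0 = *-cancelʳ-≈0 Qij≉0 (XQ∘Q≈0 i j)

    diagonal≈0 : ∀ i → X i i ≈ 0#
    diagonal≈0 i = trans (X≈YQᵀ i i) (sum-zero _ (XQ∘Q≈0 i))

    fullRow⇒row≈0 : ∀ {i} → (∀ j → ¬ Q i j ≈ 0#) → ∀ k → X i k ≈ 0#
    fullRow⇒row≈0 {i} full k = trans (X≈YQᵀ i k)
      (sum-zero _ (λ j → trans (*-congʳ (Y≈0 (full j))) (zeroˡ (Q k j))))

    Y≈two-terms : ∀ {u v w} j → v ≢ w → (∀ k → k ≢ u → k ≢ v → k ≢ w → X u k ≈ 0#) →
                  Y u j ≈ X u v * Q v j + X u w * Q w j
    Y≈two-terms {u} {v} {w} j v≢w X≈0 =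
      trans (mul≈sum X Q u j) (sum-pair _ v≢w vanish)
      where
      vanish : ∀ k → k ≢ v → k ≢ w → X u k * Q k j ≈ 0#
      vanish k k≢v k≢w with k Fin.≟ u
      ... | yes ≡.refl = trans (*-congʳ (diagonal≈0 k)) (zeroˡ (Q k j))
      ... | no  k≢u    = trans (*-congʳ (X≈0 k k≢u k≢v k≢w)) (zeroˡ (Q k j))

    module _ {R : List (Fin m)} (R-length : length R ℕ.≤ 3)
             (support : ∀ {u k} → ¬ X u k ≈ 0# → k ∈ R)
      where

      outside-three≈0 : ∀ {a b c} → a ≢ b → a ≢ c → b ≢ c → a ∈ R → b ∈ R → c ∈ R →
                        ∀ {u k} → k ≢ a → k ≢ b → k ≢ c → X u k ≈ 0#
      outside-three≈0 {a} {b} {c} a≢b a≢c b≢c a∈R b∈R c∈R {u} {k} k≢a k≢b k≢c =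
        ≈0-stable λ Xuk≉0 →
        contradiction (≤-trans (Unique-⊆⇒length≤ unique (members (support Xuk≉0))) R-length)
                      λ { (ℕ.s≤s (ℕ.s≤s (ℕ.s≤s ()))) }
        where
        unique : Unique (a ∷ b ∷ c ∷ k ∷ [])
        unique = (a≢b ∷ a≢c ∷ (k≢a ∘ ≡.sym) ∷ []) ∷ (b≢c ∷ (k≢b ∘ ≡.sym) ∷ [])
               ∷ ((k≢c ∘ ≡.sym) ∷ []) ∷ [] ∷ []
        members : k ∈ R → (a ∷ b ∷ c ∷ k ∷ []) ⊆ R
        members k∈R (here ≡.refl)                         = a∈R
        members k∈R (there (here ≡.refl))                 = b∈R
        members k∈R (there (there (here ≡.refl)))         = c∈R
        members k∈R (there (there (there (here ≡.refl)))) = k∈R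

      offDiagonal≈0 : ∀ {a b j} → a ≢ b → ¬ Q a j ≈ 0# → ¬ Q b j ≈ 0# → X a b ≈ 0#
      offDiagonal≈0 {a} {b} {j} a≢b Qaj≉0 Qbj≉0 with ≈0? (X a b)
      ... | yes Xab≈0 = Xab≈0
      ... | no  Xab≉0
        with any? (λ c → ¬? (c Fin.≟ a) ×-dec ¬? (c Fin.≟ b) ×-dec ¬? (≈0? (X a c)))
      ...   | no ¬third = *-cancelʳ-≈0 Qbj≉0 (begin
        X a b * Q b j                    ≈⟨ +-identityˡ _ ⟨
        0# + X a b * Q b j               ≈⟨ +-congʳ (trans (*-congʳ (diagonal≈0 a)) (zeroˡ _)) ⟨
        X a a * Q a j + X a b * Q b j    ≈⟨ Y≈two-terms j a≢b (λ k k≢a _ k≢b →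
                                              ≈0-stable λ Xak≉0 → ¬third (k , k≢a , k≢b , Xak≉0)) ⟨
        Y a j                            ≈⟨ Y≈0 Qaj≉0 ⟩
        0#                               ∎)
      ...   | yes (c , c≢a , c≢b , Xac≉0) =
        *-cancelʳ-≈0 Qaj≉0 (*-cancelʳ-≈0 Qbj≉0 (hollow-symmetric-3×3 eqa eqb eqc))
        where
        outside : ∀ {u k} → k ≢ a → k ≢ b → k ≢ c → X u k ≈ 0#
        outside = outside-three≈0 a≢b (c≢a ∘ ≡.sym) (c≢b ∘ ≡.sym)
          (support (λ Xba≈0 → Xab≉0 (trans (X-sym a b) Xba≈0))) (support Xab≉0) (support Xac≉0)
        eqa : X a b * Q b j + X a c * Q c j ≈ 0#
        eqa = trans (sym (Y≈two-terms j (c≢b ∘ ≡.sym) λ _ k≢a k≢b k≢c → outside k≢a k≢b k≢c))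
                    (Y≈0 Qaj≉0)
        eqb : X a b * Q a j + X b c * Q c j ≈ 0#
        eqb = begin
          X a b * Q a j + X b c * Q c j  ≈⟨ +-congʳ (*-congʳ (X-sym a b)) ⟩
          X b a * Q a j + X b c * Q c j  ≈⟨ Y≈two-terms j (c≢a ∘ ≡.sym)
                                               (λ _ k≢b k≢a k≢c → outside k≢a k≢b k≢c) ⟨
          Y b j                          ≈⟨ Y≈0 Qbj≉0 ⟩
          0#                             ∎
        eqc : (X a c * Q a j + X b c * Q b j) * Q c j ≈ 0#
        eqc = begin
          (X a c * Q a j + X b c * Q b j) * Q c j  ≈⟨ *-congʳ (+-cong (*-congʳ (X-sym a c))
                                                                     (*-congʳ (X-sym b c))) ⟩
          (X c a * Q a j + X c b * Q b j) * Q c j  ≈⟨ *-congʳ (Y≈two-terms j a≢b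
                                                        (λ _ k≢c k≢a k≢b → outside k≢a k≢b k≢c)) ⟨
          Y c j * Q c j                            ≈⟨ XQ∘Q≈0 c j ⟩
          0#                                       ∎

  ZerosInAtMostThreeRows⇒SIPP : ∀ {m n} (S : SignPattern m n) →
    ZerosInAtMostThreeRows S → NoCombOrthPair S →
    (Q : Matrix m n) → RowOrthogonal Q → HasSignPattern Q S → SIPP Q
  ZerosInAtMostThreeRows⇒SIPP S (R , R-length , zero⇒∈R) noPair Q Q-ro Q~S X X-sym XQ∘Q≈0 =
    entry≈0
    where
    nonzero : ∀ {i j} → S i j ≢ zer → ¬ Q i j ≈ 0#
    nonzero {i} {j} = HasSign⇒≉0 (S i j) (Q~S i j)
    support : ∀ {u k} → ¬ X u k ≈ 0# → k ∈ R
    support {u} {k} Xuk≉0 = decidable-stable (Any.any? (k Fin.≟_) R) λ k∉R →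
      Xuk≉0 (trans (X-sym u k) (fullRow⇒row≈0 Q-ro X-sym XQ∘Q≈0
        (λ j → nonzero (k∉R ∘ zero⇒∈R k j)) u))
    entry≈0 : X ≈ᴹ zeroMatrix
    entry≈0 i k with i Fin.≟ k
    ... | yes ≡.refl = diagonal≈0 Q-ro X-sym XQ∘Q≈0 i
    ... | no  i≢k    with j , Sij≢0 , Skj≢0 ← ¬CombOrth⇒commonSupport S (noPair i k i≢k) =
      offDiagonal≈0 Q-ro X-sym XQ∘Q≈0 R-length support i≢k (nonzero Sij≢0) (nonzero Skj≢0)

corollary3p17 : (ℝ : RealField) → let open Matrices ℝ in
    (m n : ℕ) (S : SignPattern m n) →
    AllowsRowOrthogonality S → ZerosInAtMostThreeRows S → NoCombOrthPair S →
    RequiresOSIPP S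
corollary3p17 ℝ m n S allows zeros noPair = allows , ZerosInAtMostThreeRows⇒SIPP ℝ S zeros noPair
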